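{- Let $t, m \in \mathbb{N}$, let $k = 2t+16$ and $n = \max\{2k^2k!+3,\ m-3+3k\}$. Let $G_{t,m}$ be the graph with vertex set $A \cup Q$, where $A=\{a_1,\dots,a_n\}$ and $Q = \{b_S : S \subseteq [n], |S| = k\}$, in which $A$ is a clique, $Q$ is a clique, and $a_i$ is adjacent to $b_S$ if and only if $i \in S$. (Equivalently, $G_{t,m}$ is the complement of the comparability graph of the poset of $k$-element and $(n-1)$-element subsets of $[n]$ ordered by inclusion.) Then $bend(G_{t,m}) \leq 4t+29$.
   Context: A path is a simple, piecewise linear curve in the plane made up of alternating horizontal and vertical line segments; a $k$-bend path is a path made up of at most $k+1$ such segments. A $B_k$-VPG representation of a graph $G$ is a collection of $k$-bend paths, one for each vertex, such that two paths intersect if and only if the corresponding vertices are adjacent. The bend number $bend(G)$ is the minimum $k$ such that $G$ has a $B_k$-VPG representation. -}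

module Defs where

open import Data.Nat as ℕ using (ℕ; zero; suc; _+_; _*_; _∸_; _^_; _!; _⊔_)
open import Data.Integer as ℤ using (ℤ)
open import Data.Fin using (Fin; toℕ; inject₁)
  renaming (zero to fzero; suc to fsuc)
open import Data.Fin.Subset using (Subset; ∣_∣; _∈_)
open import Data.Product using (Σ; ∃; _×_; _,_; proj₁; proj₂)
open import Data.Sum using (_⊎_; inj₁; inj₂)
open import Data.Empty using (⊥)
open import Relation.Nullary using (¬_)
open import Relation.Binary.PropositionalEquality using (_≡_; _≢_)
open import Level using (Level; 0ℓ) renaming (suc to lsuc)

record Graph : Set₁ where
  field
    V   : Set
    Adj : V → V → Set

Point : Set
Point = ℤ × ℤ

xc yc : Point → ℤ
xc = proj₁
yc = proj₂

-- z lies on the closed straight segment [p, q] (p, q axis-aligned).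
OnSeg : Point → Point → Point → Set
OnSeg p q z =
  (xc p ℤ.⊓ xc q ℤ.≤ xc z) × (xc z ℤ.≤ xc p ℤ.⊔ xc q) ×
  (yc p ℤ.⊓ yc q ℤ.≤ yc z) × (yc z ℤ.≤ yc p ℤ.⊔ yc q)

Horizontal : Point → Point → Set
Horizontal p q = (yc p ≡ yc q) × (xc p ≢ xc q)

Vertical : Point → Point → Set
Vertical p q = (xc p ≡ xc q) × (yc p ≢ yc q)

-- A path with b bends: (b + 1) segments, given by its (b + 2) corner
-- points; segment i joins corner i and corner (i+1).
module _ {b : ℕ} (corner : Fin (suc (suc b)) → Point) where

  segStart segEnd : Fin (suc b) → Point
  segStart i = corner (inject₁ i)
  segEnd   i = corner (fsuc i)

  record IsPath : Set where
    field
      axis : ∀ i → Horizontal (segStart i) (segEnd i) ⊎ Vertical (segStart i) (segEnd i)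
      alt  : ∀ (i : Fin b) →
               ¬ (Horizontal (segStart (inject₁ i)) (segEnd (inject₁ i)) ×
                  Horizontal (segStart (fsuc i)) (segEnd (fsuc i))) ×
               ¬ (Vertical (segStart (inject₁ i)) (segEnd (inject₁ i)) ×
                  Vertical (segStart (fsuc i)) (segEnd (fsuc i)))
      -- simplicity: non-consecutive segments are disjoint (consecutive
      -- perpendicular segments meet only in their common corner)
      simple : ∀ (i j : Fin (suc b)) → suc (toℕ i) ℕ.< toℕ j →
                 ∀ z → ¬ (OnSeg (segStart i) (segEnd i) z × OnSeg (segStart j) (segEnd j) z)

  OnCurve : Point → Set
  OnCurve z = ∃ λ i → OnSeg (segStart i) (segEnd i) z

record Path : Set where
  field
    bends  : ℕ
    corner : Fin (suc (suc bends)) → Point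
    isPath : IsPath corner

  OnPath : Point → Set
  OnPath = OnCurve corner

open Path public using (bends; OnPath)

Meet : Path → Path → Set
Meet P Q = ∃ λ z → OnPath P z × OnPath Q z

record BkVPG (k : ℕ) (G : Graph) : Set where
  open Graph G
  field
    path     : V → Path
    kbend    : ∀ v → bends (path v) ℕ.≤ k
    sound    : ∀ u v → u ≢ v → Adj u v → Meet (path u) (path v)
    complete : ∀ u v → u ≢ v → Meet (path u) (path v) → Adj u v

-- bend(G) ≤ b  iff  G has a B_b-VPG representation
-- (a k-bend path is by definition also a k'-bend path for k ≤ k').
bend≤ : Graph → ℕ → Set
bend≤ G b = BkVPG b G

kOf : ℕ → ℕ
kOf t = 2 * t + 16

nOf : ℕ → ℕ → ℕ
nOf t m = (2 * (kOf t ^ 2) * (kOf t !) + 3) ⊔ ((m ∸ 3) + 3 * kOf t)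

KSubset : ℕ → ℕ → Set
KSubset n k = Σ (Subset n) λ S → ∣ S ∣ ≡ k

GAdj : ∀ n k → Fin n ⊎ KSubset n k → Fin n ⊎ KSubset n k → Set
GAdj n k (inj₁ i) (inj₁ j) = i ≢ j
GAdj n k (inj₂ S) (inj₂ T) = proj₁ S ≢ proj₁ T
GAdj n k (inj₁ i) (inj₂ S) = i ∈ proj₁ S
GAdj n k (inj₂ S) (inj₁ i) = i ∈ proj₁ S

Gtm : ℕ → ℕ → Graph
Gtm t m = record
  { V   = Fin (nOf t m) ⊎ KSubset (nOf t m) (kOf t)
  ; Adj = GAdj (nOf t m) (kOf t)
  }

-- Vertex a_i is drawn as a staircase below the diagonal and b_S as a staircase
-- above it, both with b + 1 axis-parallel steps.  With N = n + 1, the staircase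
-- of a strictly increasing sequence q touches the diagonal exactly at the points
-- (q l , q l); we use q l = i + l N for a_i and q l = s_l + l N for b_S, where
-- s_l is the l-th element of S.  A staircase above and one below the diagonal can
-- only meet on it, hence at a common value i + l N = s_l' + l' N, which forces
-- i = s_l' ∈ S; conversely i = s_l gives the common corner 2l, which exists since
-- 2l ≤ 2(k - 1) ≤ b + 1.  Two staircases on the same side always cross, because
-- the values of any two such sequences interlace level by level.
module Submission where

open import Defs
open import Data.Nat as ℕ using (ℕ; zero; suc; _+_; _*_; z≤n; s≤s; _%_)
import Data.Nat.Properties as ℕP
open import Data.Nat.DivMod using ([m+kn]%n≡m%n; m<n⇒m%n≡m)
open import Data.Nat.Tactic.RingSolver using (solve-∀)
open import Data.Integer as ℤ using (+_)
import Data.Integer.Properties as ℤP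
open import Data.Fin using (Fin; toℕ; inject₁; fromℕ<) renaming (zero to fzero; suc to fsuc)
open import Data.Fin.Properties using (toℕ-inject₁; toℕ-fromℕ<; toℕ<n)
open import Data.Fin.Subset using (Subset; ∣_∣; _∈_)
open import Data.Vec using ([]; _∷_; here; there)
open import Data.Bool using (true; false)
open import Data.Product using (∃; _×_; _,_; proj₁; proj₂)
open import Data.Sum using (_⊎_; inj₁; inj₂)
open import Function using (_∘_)
open import Relation.Nullary using (¬_)
open import Relation.Binary.PropositionalEquality

swap : Point → Point
swap (x , y) = y , x

_≤P_ : Point → Point → Set
p ≤P q = (xc p ℤ.≤ xc q) × (yc p ℤ.≤ yc q)

_<P_ : Point → Point → Set
p <P q = (xc p ℤ.< xc q) × (yc p ℤ.< yc q)

≤P-trans : ∀ {p q r} → p ≤P q → q ≤P r → p ≤P r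
≤P-trans (x₁ , y₁) (x₂ , y₂) = ℤP.≤-trans x₁ x₂ , ℤP.≤-trans y₁ y₂

onSeg-swap : ∀ {p q z} → OnSeg p q z → OnSeg (swap p) (swap q) (swap z)
onSeg-swap (x₁ , x₂ , y₁ , y₂) = y₁ , y₂ , x₁ , x₂

onSeg-start : ∀ {p q} → OnSeg p q p
onSeg-start = ℤP.i⊓j≤i _ _ , ℤP.i≤i⊔j _ _ , ℤP.i⊓j≤i _ _ , ℤP.i≤i⊔j _ _

onSeg-end : ∀ {p q} → OnSeg p q q
onSeg-end = ℤP.i⊓j≤j _ _ , ℤP.i≤j⊔i _ _ , ℤP.i⊓j≤j _ _ , ℤP.i≤j⊔i _ _

between⇒onSeg : ∀ {p q z} → p ≤P z → z ≤P q → OnSeg p q z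
between⇒onSeg (x₁ , y₁) (x₂ , y₂) =
  ℤP.≤-trans (ℤP.i⊓j≤i _ _) x₁ , ℤP.≤-trans x₂ (ℤP.i≤j⊔i _ _) ,
  ℤP.≤-trans (ℤP.i⊓j≤i _ _) y₁ , ℤP.≤-trans y₂ (ℤP.i≤j⊔i _ _)

onSeg⇒between : ∀ {p q z} → p ≤P q → OnSeg p q z → p ≤P z × z ≤P q
onSeg⇒between (x≤ , y≤) (x₁ , x₂ , y₁ , y₂) =
  (subst (ℤ._≤ _) (ℤP.i≤j⇒i⊓j≡i x≤) x₁ , subst (ℤ._≤ _) (ℤP.i≤j⇒i⊓j≡i y≤) y₁) ,
  (subst (_ ℤ.≤_) (ℤP.i≤j⇒i⊔j≡j x≤) x₂ , subst (_ ℤ.≤_) (ℤP.i≤j⇒i⊔j≡j y≤) y₂)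

meet-sym : ∀ {P Q} → Meet P Q → Meet Q P
meet-sym (z , onP , onQ) = z , onQ , onP

UpStep RightStep : Point → Point → Set
UpStep p q = xc p ≡ xc q × yc p ℤ.< yc q
RightStep p q = yc p ≡ yc q × xc p ℤ.< xc q

record IsStaircase (C : ℕ → Point) : Set where
  field
    step    : ∀ m → UpStep (C m) (C (suc m)) ⊎ RightStep (C m) (C (suc m))
    twoStep : ∀ m → C m <P C (suc (suc m))

isStaircase-swap : ∀ {C} → IsStaircase C → IsStaircase (swap ∘ C)
isStaircase-swap {C} st = record { step = step ; twoStep = twoStep }
  where
  step : ∀ m → UpStep (swap (C m)) (swap (C (suc m))) ⊎ RightStep (swap (C m)) (swap (C (suc m)))
  step m with IsStaircase.step st m
  ... | inj₁ up    = inj₂ up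
  ... | inj₂ right = inj₁ right

  twoStep : ∀ m → swap (C m) <P swap (C (suc (suc m)))
  twoStep m = let (x< , y<) = IsStaircase.twoStep st m in y< , x<

module Staircase (C : ℕ → Point) (st : IsStaircase C) where
  open IsStaircase st

  Segment : ℕ → Point → Set
  Segment m = OnSeg (C m) (C (suc m))

  ≤P-step : ∀ m → C m ≤P C (suc m)
  ≤P-step m with step m
  ... | inj₁ (x≡ , y<) = ℤP.≤-reflexive x≡ , ℤP.<⇒≤ y<
  ... | inj₂ (y≡ , x<) = ℤP.<⇒≤ x< , ℤP.≤-reflexive y≡

  ≤P-mono : ∀ {m m'} → m ℕ.≤ m' → C m ≤P C m'
  ≤P-mono {m} {m'} m≤m' with ℕP.m≤n⇒∃[o]m+o≡n m≤m'
  ... | d , refl = go d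
    where
    go : ∀ d → C m ≤P C (m + d)
    go zero    rewrite ℕP.+-identityʳ m = ℤP.≤-refl , ℤP.≤-refl
    go (suc d) rewrite ℕP.+-suc m d     = ≤P-trans (go d) (≤P-step (m + d))

  axis : ∀ m → Horizontal (C m) (C (suc m)) ⊎ Vertical (C m) (C (suc m))
  axis m with step m
  ... | inj₁ (x≡ , y<) = inj₂ (x≡ , ℤP.<⇒≢ y<)
  ... | inj₂ (y≡ , x<) = inj₁ (y≡ , ℤP.<⇒≢ x<)

  no-straight-bend : ∀ m →
    ¬ (Horizontal (C m) (C (suc m)) × Horizontal (C (suc m)) (C (suc (suc m)))) ×
    ¬ (Vertical (C m) (C (suc m)) × Vertical (C (suc m)) (C (suc (suc m))))
  no-straight-bend m =
    (λ ((y≡₁ , _) , (y≡₂ , _)) → ℤP.<⇒≢ (proj₂ (twoStep m)) (trans y≡₁ y≡₂)) ,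
    (λ ((x≡₁ , _) , (x≡₂ , _)) → ℤP.<⇒≢ (proj₁ (twoStep m)) (trans x≡₁ x≡₂))

  -- Segment m' starts weakly above-right of C (m + 2), which is strictly
  -- above or right of every point of segment m.
  segments-disjoint : ∀ m m' → suc m ℕ.< m' → ∀ z → ¬ (Segment m z × Segment m' z)
  segments-disjoint m m' m+1<m' z (on₁ , on₂)
    with onSeg⇒between (≤P-step m) on₁ | onSeg⇒between (≤P-step m') on₂
  ... | _ , (x₁ , y₁) | (x₂ , y₂) , _ with step (suc m) | ≤P-mono m+1<m'
  ...   | inj₁ (_ , y<) | _ , y≤ = ℤP.<⇒≱ y< (ℤP.≤-trans y≤ (ℤP.≤-trans y₂ y₁))
  ...   | inj₂ (_ , x<) | x≤ , _ = ℤP.<⇒≱ x< (ℤP.≤-trans x≤ (ℤP.≤-trans x₂ x₁))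

  module _ (b : ℕ) where
    corner : Fin (suc (suc b)) → Point
    corner c = C (toℕ c)

    isPath : IsPath corner
    isPath = record { axis = axisᶠ ; alt = altᶠ ; simple = simpleᶠ }
      where
      axisᶠ : ∀ (i : Fin (suc b)) →
        Horizontal (C (toℕ (inject₁ i))) (C (suc (toℕ i))) ⊎ Vertical (C (toℕ (inject₁ i))) (C (suc (toℕ i)))
      axisᶠ i rewrite toℕ-inject₁ i = axis (toℕ i)

      altᶠ : ∀ (i : Fin b) →
        ¬ (Horizontal (C (toℕ (inject₁ (inject₁ i)))) (C (suc (toℕ (inject₁ i)))) ×
           Horizontal (C (suc (toℕ (inject₁ i)))) (C (suc (suc (toℕ i))))) ×
        ¬ (Vertical (C (toℕ (inject₁ (inject₁ i)))) (C (suc (toℕ (inject₁ i)))) ×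
           Vertical (C (suc (toℕ (inject₁ i)))) (C (suc (suc (toℕ i)))))
      altᶠ i rewrite toℕ-inject₁ (inject₁ i) | toℕ-inject₁ i = no-straight-bend (toℕ i)

      simpleᶠ : ∀ (i j : Fin (suc b)) → suc (toℕ i) ℕ.< toℕ j → ∀ z →
        ¬ (OnSeg (C (toℕ (inject₁ i))) (C (suc (toℕ i))) z × OnSeg (C (toℕ (inject₁ j))) (C (suc (toℕ j))) z)
      simpleᶠ i j rewrite toℕ-inject₁ i | toℕ-inject₁ j = segments-disjoint (toℕ i) (toℕ j)

    path : Path
    path = record { bends = b ; corner = corner ; isPath = isPath }

    segment⇒onPath : ∀ {m z} → m ℕ.< suc b → Segment m z → OnPath path z
    segment⇒onPath m<b+1 on with fromℕ< m<b+1 | toℕ-fromℕ< m<b+1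
    ... | i | refl = i , subst (λ a → OnSeg (C a) (C (suc (toℕ i))) _) (sym (toℕ-inject₁ i)) on

    corner⇒onPath : ∀ {m} → m ℕ.≤ suc b → OnPath path (C m)
    corner⇒onPath m≤b+1 with ℕP.m≤n⇒m<n∨m≡n m≤b+1
    ... | inj₁ m<b+1 = segment⇒onPath m<b+1 onSeg-start
    ... | inj₂ refl  = segment⇒onPath ℕP.≤-refl onSeg-end

    onPath⇒segment : ∀ {z} → OnPath path z → ∃ λ m → Segment m z
    onPath⇒segment (i , on) = toℕ i , subst (λ a → OnSeg (C a) (C (suc (toℕ i))) _) (toℕ-inject₁ i) on

Increasing : (ℕ → ℕ) → Set
Increasing q = ∀ l → q l ℕ.< q (suc l)

above : (ℕ → ℕ) → ℕ → Point
above q zero          = + q 0 , + q 0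
above q (suc zero)    = + q 0 , + q 1
above q (suc (suc m)) = above (q ∘ suc) m

below : (ℕ → ℕ) → ℕ → Point
below q = swap ∘ above q

above-double : ∀ q l → above q (l + l) ≡ (+ q l , + q l)
above-double q zero = refl
above-double q (suc l) rewrite ℕP.+-suc l l = above-double (q ∘ suc) l

above-step : ∀ {q} → Increasing q → ∀ m →
  UpStep (above q m) (above q (suc m)) ⊎ RightStep (above q m) (above q (suc m))
above-step inc zero          = inj₁ (refl , ℤ.+<+ (inc 0))
above-step inc (suc zero)    = inj₂ (refl , ℤ.+<+ (inc 0))
above-step inc (suc (suc m)) = above-step (inc ∘ suc) m

above-twoStep : ∀ {q} → Increasing q → ∀ m → above q m <P above q (suc (suc m))
above-twoStep inc zero          = ℤ.+<+ (inc 0) , ℤ.+<+ (inc 0)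
above-twoStep inc (suc zero)    = ℤ.+<+ (inc 0) , ℤ.+<+ (inc 1)
above-twoStep inc (suc (suc m)) = above-twoStep (inc ∘ suc) m

above-isStaircase : ∀ {q} → Increasing q → IsStaircase (above q)
above-isStaircase inc = record { step = above-step inc ; twoStep = above-twoStep inc }

abovePath belowPath : ∀ q → Increasing q → ℕ → Path
abovePath q inc = Staircase.path (above q) (above-isStaircase inc)
belowPath q inc = Staircase.path (below q) (isStaircase-swap (above-isStaircase inc))

onAbove⇒onBelow : ∀ {q} (inc : Increasing q) b {z} →
  OnPath (abovePath q inc b) z → OnPath (belowPath q inc b) (swap z)
onAbove⇒onBelow _ _ (i , on) = i , onSeg-swap on

onBelow⇒onAbove : ∀ {q} (inc : Increasing q) b {z} →
  OnPath (belowPath q inc b) z → OnPath (abovePath q inc b) (swap z)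
onBelow⇒onAbove _ _ (i , on) = i , onSeg-swap on

AboveDiagonal : (ℕ → ℕ) → Point → Set
AboveDiagonal q z = xc z ℤ.≤ yc z × (xc z ≡ yc z → ∃ λ l → xc z ≡ + q l)

above-segment-aboveDiagonal : ∀ {q} → Increasing q → ∀ m {z} →
  OnSeg (above q m) (above q (suc m)) z → AboveDiagonal q z
above-segment-aboveDiagonal inc zero on
  with onSeg⇒between (ℤP.≤-refl , ℤ.+≤+ (ℕP.<⇒≤ (inc 0))) on
... | (x₁ , y₁) , (x₂ , _) =
  let x≡q₀ = ℤP.≤-antisym x₂ x₁ in ℤP.≤-trans (ℤP.≤-reflexive x≡q₀) y₁ , λ _ → 0 , x≡q₀
above-segment-aboveDiagonal inc (suc zero) on
  with onSeg⇒between (ℤ.+≤+ (ℕP.<⇒≤ (inc 0)) , ℤP.≤-refl) on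
... | (_ , y₁) , (x₂ , y₂) =
  let y≡q₁ = ℤP.≤-antisym y₂ y₁ in ℤP.≤-trans x₂ (ℤP.≤-reflexive (sym y≡q₁)) , λ x≡y → 1 , trans x≡y y≡q₁
above-segment-aboveDiagonal inc (suc (suc m)) on
  with above-segment-aboveDiagonal (inc ∘ suc) m on
... | x≤y , diagonal = x≤y , λ x≡y → let (l , x≡) = diagonal x≡y in suc l , x≡

onAbove⇒aboveDiagonal : ∀ {q} (inc : Increasing q) b {z} →
  OnPath (abovePath q inc b) z → AboveDiagonal q z
onAbove⇒aboveDiagonal {q} inc b on with Staircase.onPath⇒segment (above q) (above-isStaircase inc) b on
... | m , onSeg = above-segment-aboveDiagonal inc m onSeg

-- The point (q 1 , r 1) lies on segment 2 of the first and segment 1 of the second.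
above-meet : ∀ {q r} (incq : Increasing q) (incr : Increasing r) {b} → 2 ℕ.≤ b →
  r 0 ℕ.≤ q 1 → q 1 ℕ.≤ r 1 → r 1 ℕ.≤ q 2 → Meet (abovePath q incq b) (abovePath r incr b)
above-meet {q} {r} incq incr {b} 2≤b r₀≤q₁ q₁≤r₁ r₁≤q₂ =
  (+ q 1 , + r 1) ,
  Staircase.segment⇒onPath (above q) (above-isStaircase incq) b (s≤s 2≤b)
    (between⇒onSeg (ℤP.≤-refl , ℤ.+≤+ q₁≤r₁) (ℤP.≤-refl , ℤ.+≤+ r₁≤q₂)) ,
  Staircase.segment⇒onPath (above r) (above-isStaircase incr) b (s≤s (ℕP.≤-trans (s≤s z≤n) 2≤b))
    (between⇒onSeg (ℤ.+≤+ r₀≤q₁ , ℤP.≤-refl) (ℤ.+≤+ q₁≤r₁ , ℤP.≤-refl))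

Interlaced : (ℕ → ℕ) → (ℕ → ℕ) → Set
Interlaced q r = ∀ l → q l ℕ.< r (suc l) × r l ℕ.< q (suc l)

interlaced-above-meet : ∀ {q r} (incq : Increasing q) (incr : Increasing r) {b} → 2 ℕ.≤ b →
  Interlaced q r → Meet (abovePath q incq b) (abovePath r incr b)
interlaced-above-meet {q} {r} incq incr 2≤b lace with ℕP.≤-total (q 1) (r 1)
... | inj₁ q₁≤r₁ =
  above-meet incq incr 2≤b (ℕP.<⇒≤ (proj₂ (lace 0))) q₁≤r₁ (ℕP.<⇒≤ (proj₂ (lace 1)))
... | inj₂ r₁≤q₁ =
  meet-sym {abovePath r incr _} {abovePath q incq _}
    (above-meet incr incq 2≤b (ℕP.<⇒≤ (proj₁ (lace 0))) r₁≤q₁ (ℕP.<⇒≤ (proj₁ (lace 1))))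

interlaced-below-meet : ∀ {q r} (incq : Increasing q) (incr : Increasing r) {b} → 2 ℕ.≤ b →
  Interlaced q r → Meet (belowPath q incq b) (belowPath r incr b)
interlaced-below-meet incq incr {b} 2≤b lace with interlaced-above-meet incq incr 2≤b lace
... | z , onq , onr = swap z , onAbove⇒onBelow incq b onq , onAbove⇒onBelow incr b onr

leveled : ℕ → (ℕ → ℕ) → ℕ → ℕ
leveled N f l = f l + l * N

leveled-< : ∀ {N} f g → (∀ l → f l ℕ.< N) → ∀ l → leveled N f l ℕ.< leveled N g (suc l)
leveled-< {N} f g f<N l =
  ℕP.<-≤-trans (ℕP.+-monoˡ-< (l * N) (f<N l)) (ℕP.m≤n+m (N + l * N) (g (suc l)))

leveled-increasing : ∀ {N} f → (∀ l → f l ℕ.< N) → Increasing (leveled N f)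
leveled-increasing f f<N = leveled-< f f f<N

leveled-interlaced : ∀ {N} f g → (∀ l → f l ℕ.< N) → (∀ l → g l ℕ.< N) →
  Interlaced (leveled N f) (leveled N g)
leveled-interlaced f g f<N g<N l = leveled-< f g f<N l , leveled-< g f g<N l

a+lN≡c+l'N⇒a≡c : ∀ {N l l' a c} → a ℕ.< suc N → c ℕ.< suc N →
  a + l * suc N ≡ c + l' * suc N → a ≡ c
a+lN≡c+l'N⇒a≡c {N} {l} {l'} {a} {c} a<N c<N eq = begin
  a                        ≡⟨ m<n⇒m%n≡m a<N ⟨
  a % suc N                ≡⟨ [m+kn]%n≡m%n a l (suc N) ⟨
  (a + l * suc N) % suc N  ≡⟨ cong (_% suc N) eq ⟩
  (c + l' * suc N) % suc N ≡⟨ [m+kn]%n≡m%n c l' (suc N) ⟩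
  c % suc N                ≡⟨ m<n⇒m%n≡m c<N ⟩
  c                        ∎
  where open ≡-Reasoning

-- The position of the l-th element of p (from 0); the junk value n, which is
-- not a position, is returned when p has at most l elements.
nthMember : ∀ {n} → Subset n → ℕ → ℕ
nthMember []          l       = 0
nthMember (true ∷ p)  zero    = 0
nthMember (true ∷ p)  (suc l) = suc (nthMember p l)
nthMember (false ∷ p) l       = suc (nthMember p l)

nthMember≤ : ∀ {n} (p : Subset n) l → nthMember p l ℕ.≤ n
nthMember≤ []          l       = z≤n
nthMember≤ (true ∷ p)  zero    = z≤n
nthMember≤ (true ∷ p)  (suc l) = s≤s (nthMember≤ p l)
nthMember≤ (false ∷ p) l       = s≤s (nthMember≤ p l)

nthMember⇒∈ : ∀ {n} (p : Subset n) (i : Fin n) l → toℕ i ≡ nthMember p l → i ∈ p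
nthMember⇒∈ (true ∷ p)  fzero    zero    _  = here
nthMember⇒∈ (true ∷ p)  (fsuc i) (suc l) eq = there (nthMember⇒∈ p i l (ℕP.suc-injective eq))
nthMember⇒∈ (false ∷ p) (fsuc i) l       eq = there (nthMember⇒∈ p i l (ℕP.suc-injective eq))

∈⇒nthMember : ∀ {n} (p : Subset n) (i : Fin n) → i ∈ p → ∃ λ l → l ℕ.< ∣ p ∣ × nthMember p l ≡ toℕ i
∈⇒nthMember (true ∷ p)  fzero    here      = 0 , s≤s z≤n , refl
∈⇒nthMember (true ∷ p)  (fsuc i) (there i∈p) =
  let (l , l<∣p∣ , eq) = ∈⇒nthMember p i i∈p in suc l , s≤s l<∣p∣ , cong suc eq
∈⇒nthMember (false ∷ p) (fsuc i) (there i∈p) =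
  let (l , l<∣p∣ , eq) = ∈⇒nthMember p i i∈p in l , l<∣p∣ , cong suc eq

ksubset-≡ : ∀ {n k} (S T : KSubset n k) → proj₁ S ≡ proj₁ T → S ≡ T
ksubset-≡ (p , ∣p∣≡k) (.p , ∣p∣≡k') refl = cong (p ,_) (ℕP.≡-irrelevant ∣p∣≡k ∣p∣≡k')

subsetGraph : ℕ → ℕ → Graph
subsetGraph n k = record { V = Fin n ⊎ KSubset n k ; Adj = GAdj n k }

module _ (n k b : ℕ) (2≤b : 2 ℕ.≤ b) (k+k≤3+b : k + k ℕ.≤ 3 + b) where
  private
    N : ℕ
    N = suc n

    position<N : ∀ (i : Fin n) (l : ℕ) → toℕ i ℕ.< N
    position<N i _ = ℕP.m<n⇒m<1+n (toℕ<n i)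

    nthMember<N : ∀ (p : Subset n) l → nthMember p l ℕ.< N
    nthMember<N p l = s≤s (nthMember≤ p l)

    a : Fin n → ℕ → ℕ
    a i = leveled N (λ _ → toℕ i)

    s : Subset n → ℕ → ℕ
    s p = leveled N (nthMember p)

    a-increasing : ∀ i → Increasing (a i)
    a-increasing i = leveled-increasing _ (position<N i)

    s-increasing : ∀ p → Increasing (s p)
    s-increasing p = leveled-increasing _ (nthMember<N p)

    aPath : Fin n → Path
    aPath i = belowPath (a i) (a-increasing i) b

    sPath : Subset n → Path
    sPath p = abovePath (s p) (s-increasing p) b

    vertexPath : Fin n ⊎ KSubset n k → Path
    vertexPath (inj₁ i) = aPath i
    vertexPath (inj₂ S) = sPath (proj₁ S)

    member⇒meet : ∀ i (S : KSubset n k) → i ∈ proj₁ S → Meet (aPath i) (sPath (proj₁ S))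
    member⇒meet i (p , ∣p∣≡k) i∈p with ∈⇒nthMember p i i∈p
    ... | l , l<∣p∣ , sₗ≡i =
      below (a i) (l + l) ,
      Staircase.corner⇒onPath (below (a i)) (isStaircase-swap (above-isStaircase (a-increasing i))) b
        corner-exists ,
      subst (OnPath (sPath p)) common-corner
        (Staircase.corner⇒onPath (above (s p)) (above-isStaircase (s-increasing p)) b corner-exists)
      where
      l<k : l ℕ.< k
      l<k = subst (l ℕ.<_) ∣p∣≡k l<∣p∣

      corner-exists : l + l ℕ.≤ suc b
      corner-exists = ℕP.≤-pred (ℕP.≤-pred (subst (ℕ._≤ 3 + b) (cong suc (ℕP.+-suc l l))
        (ℕP.≤-trans (ℕP.+-mono-≤ l<k l<k) k+k≤3+b)))

      common-corner : above (s p) (l + l) ≡ below (a i) (l + l)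
      common-corner rewrite above-double (s p) l | above-double (a i) l | sₗ≡i = refl

    meet⇒member : ∀ i (S : KSubset n k) → Meet (aPath i) (sPath (proj₁ S)) → i ∈ proj₁ S
    meet⇒member i (p , _) (z , onA , onS)
      with onAbove⇒aboveDiagonal (a-increasing i) b (onBelow⇒onAbove (a-increasing i) b onA)
         | onAbove⇒aboveDiagonal (s-increasing p) b onS
    ... | y≤x , diagonalA | x≤y , diagonalS =
      let x≡y        = ℤP.≤-antisym x≤y y≤x
          (l  , y≡a) = diagonalA (sym x≡y)
          (l' , x≡s) = diagonalS x≡y
      in nthMember⇒∈ p i l' (a+lN≡c+l'N⇒a≡c {l = l} {l' = l'} (position<N i l) (nthMember<N p l')
           (ℤP.+-injective (trans (sym y≡a) (trans (sym x≡y) x≡s))))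

    sound : ∀ u v → u ≢ v → GAdj n k u v → Meet (vertexPath u) (vertexPath v)
    sound (inj₁ i) (inj₁ j) _ _ = interlaced-below-meet (a-increasing i) (a-increasing j) 2≤b
      (leveled-interlaced _ _ (position<N i) (position<N j))
    sound (inj₂ (p , _)) (inj₂ (q , _)) _ _ = interlaced-above-meet (s-increasing p) (s-increasing q) 2≤b
      (leveled-interlaced _ _ (nthMember<N p) (nthMember<N q))
    sound (inj₁ i) (inj₂ S) _ i∈S = member⇒meet i S i∈S
    sound (inj₂ S) (inj₁ i) _ i∈S = meet-sym {aPath i} {sPath (proj₁ S)} (member⇒meet i S i∈S)

    complete : ∀ u v → u ≢ v → Meet (vertexPath u) (vertexPath v) → GAdj n k u v
    complete (inj₁ i) (inj₁ j) i≢j _ = λ i≡j → i≢j (cong inj₁ i≡j)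
    complete (inj₂ S) (inj₂ T) S≢T _ = λ p≡q → S≢T (cong inj₂ (ksubset-≡ S T p≡q))
    complete (inj₁ i) (inj₂ S) _ meet = meet⇒member i S meet
    complete (inj₂ S) (inj₁ i) _ meet = meet⇒member i S (meet-sym {sPath (proj₁ S)} {aPath i} meet)

  subsetGraph-bend≤ : bend≤ (subsetGraph n k) b
  subsetGraph-bend≤ = record
    { path = vertexPath ; kbend = λ { (inj₁ _) → ℕP.≤-refl ; (inj₂ _) → ℕP.≤-refl }
    ; sound = sound ; complete = complete }

lemma4 : (t m : ℕ) → bend≤ (Gtm t m) (4 * t + 29)
lemma4 t m = subsetGraph-bend≤ (nOf t m) (kOf t) (4 * t + 29) 2≤b (ℕP.≤-reflexive (k+k≡3+b t))
  where
  2≤b : 2 ℕ.≤ 4 * t + 29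
  2≤b = ℕP.≤-trans (ℕP.m≤m+n 2 27) (ℕP.m≤n+m 29 (4 * t))

  k+k≡3+b : ∀ t → (2 * t + 16) + (2 * t + 16) ≡ 3 + (4 * t + 29)
  k+k≡3+b = solve-∀
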